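{- (Soundness) Let $\sigma$ be a PCF type and let $s,t$ be PCF terms of type $\sigma$. If $s\leadsto^* t$, then $[\![s]\!]=[\![t]\!]$.
   Context: Ambient theory: intensional Martin-Löf type theory with function extensionality, propositional extensionality and propositional truncation $\|-\|$. There are universes $\mathcal U_0:\mathcal U_1$ with $\mathbb N:\mathcal U_0$, and $\Omega$ is the type of propositions in $\mathcal U_0$. PCF types are $\iota$ and $\sigma\Rightarrow\tau$. PCF terms are generated inductively by the following constants and application: - $\mathsf{zero}:\iota$; - $\mathsf{succ},\mathsf{pred}:\iota\Rightarrow\iota$; - $\mathsf{ifz}:\iota\Rightarrow\iota\Rightarrow\iota\Rightarrow\iota$; - $\mathsf k_{\sigma,\tau}:\sigma\Rightarrow\tau\Rightarrow\sigma$; - $\mathsf s_{\sigma,\tau,\rho}:(\sigma\Rightarrow\tau\Rightarrow\rho)\Rightarrow(\sigma\Rightarrow\tau)\Rightarrow\sigma\Rightarrow\rho$; - $\mathsf{fix}_\sigma:(\sigma\Rightarrow\sigma)\Rightarrow\sigma$; - application $st:\tau$ for $s:\sigma\Rightarrow\tau$ and $t:\sigma$ (left associative). Numerals: $\underline 0:=\mathsf{zero}$ and $\underline{n+1}:=\mathsf{succ}\,\underline n$. The relation $\tilde\leadsto$ is the inductive family generated by: - $\mathsf{pred}\,\underline0\tilde\leadsto\underline0$; - $\mathsf{pred}\,\underline{n+1}\tilde\leadsto\underline n$; - $\mathsf{ifz}\,s\,t\,\underline0\tilde\leadsto s$; - $\mathsf{ifz}\,s\,t\,\underline{n+1}\tilde\leadsto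 t$; - $\mathsf k s t\tilde\leadsto s$; - $\mathsf s f g t\tilde\leadsto ft(gt)$; - $\mathsf{fix}\,f\tilde\leadsto f(\mathsf{fix}\,f)$; - if $f\tilde\leadsto g$ then $ft\tilde\leadsto gt$; - if $s\tilde\leadsto t$ then $\mathsf{succ}\,s\tilde\leadsto\mathsf{succ}\,t$ and $\mathsf{pred}\,s\tilde\leadsto\mathsf{pred}\,t$; - if $r\tilde\leadsto r'$ then $\mathsf{ifz}\,s\,t\,r\tilde\leadsto\mathsf{ifz}\,s\,t\,r'$. Set $s\leadsto t:=\|s\tilde\leadsto t\|$. For a proposition-valued relation $R$, $R_*$ is the inductive family with constructors $\mathsf{extend}:xRy\to xR_*y$, $\mathsf{refl}:xR_*x$ and $\mathsf{trans}:xR_*y\to yR_*z\to xR_*z$. Its truncation is $xR^*y:=\|xR_*y\|$, and $\leadsto^*$ is this closure of $\leadsto$. Semantics. The lifting is $\mathcal L(X):=\sum_{P:\Omega}(P\to X)$ with $\mathrm{isdefined}$ the first projection and $\mathrm{value}(P,\varphi)(p)=\varphi(p)$. We write $\eta(x):=(\mathbf 1,\lambda t.x)$ and $\bot:=(\mathbf 0,!)$. For a set $X$, $\mathcal L(X)$ is a dcpo with $\bot$, with order $l\sqsubseteq m:=(\mathrm{isdefined}(l)\to l=m)$. A dcpo with $\bot$ is a poset (a set with a proposition-valued partial order) with a least element and least upper bounds of all directed families indexed by types in $\mathcal U_0$. A family $u:I\to X$ is directed if $\|I\|$ holds and $\prod_{i,j}\|\sum_k u_i\le u_k\times u_j\le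 u_k\|$. For dcpos with $\bot$ $D,E$, $E^D$ is the dcpo with $\bot$ of continuous (directed-sup-preserving) maps, ordered pointwise. Interpretation of types: $[\![\iota]\!]:=\mathcal L(\mathbb N)$ and $[\![\sigma\Rightarrow\tau]\!]:=[\![\tau]\!]^{[\![\sigma]\!]}$. Interpretation of terms: - $[\![\mathsf{zero}]\!]=\eta(0)$; - $[\![\mathsf{succ}]\!]=\mathcal L(\mathrm{succ})$ and $[\![\mathsf{pred}]\!]=\mathcal L(\mathrm{pred})$, where $\mathcal L(f)(P,\varphi)=(P,f\circ\varphi)$; - $[\![\mathsf{ifz}]\!]=\lambda x,y.(\chi_{x,y})^\#$, where $\chi_{x,y}(0)=x$, $\chi_{x,y}(n+1)=y$, and $g^\#(P,\varphi)=(\sum_{p:P}\mathrm{isdefined}(g(\varphi p)),(p,d)\mapsto\mathrm{value}(g(\varphi p))(d))$; - $[\![\mathsf k]\!]=\lambda x,y.x$; - $[\![\mathsf s]\!]=\lambda f,g,x.f(x)(g(x))$; - $[\![\mathsf{fix}]\!]=\mu$ with $\mu(f)=\bigsqcup_n f^n(\bot)$; - $[\![st]\!]=[\![s]\!]([\![t]\!])$. -}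

{-# OPTIONS --without-K #-}
module Defs where

open import Level using (Level; Setω) renaming (_⊔_ to _⊔ℓ_)
open import Data.Nat using (ℕ; zero; suc; _+_) renaming (pred to ℕpred)
open import Data.Nat.Properties using (+-comm) renaming (≡-irrelevant to ℕ-irr)
open import Data.Product using (Σ; _×_; _,_; proj₁; proj₂)
open import Data.Unit using (⊤; tt)
open import Data.Empty using () renaming (⊥ to 𝟘)
open import Data.Bool using (Bool; true; false)
open import Function using (_∘_; id)
open import Relation.Binary.PropositionalEquality
  using (_≡_; refl; sym; trans; cong; cong₂; subst)
open import Relation.Binary.PropositionalEquality.Properties using (trans-symˡ)
open import Axiom.Extensionality.Propositional using (Extensionality)

infixr 30 _⇒_
data Ty : Set where
  ι   : Ty
  _⇒_ : Ty → Ty → Ty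

infixl 40 _·_
data Tm : Ty → Set where
  Zero : Tm ι
  Succ : Tm (ι ⇒ ι)
  Pred : Tm (ι ⇒ ι)
  Ifz  : Tm (ι ⇒ ι ⇒ ι ⇒ ι)
  K    : {σ τ : Ty} → Tm (σ ⇒ τ ⇒ σ)
  S    : {σ τ ρ : Ty} → Tm ((σ ⇒ τ ⇒ ρ) ⇒ (σ ⇒ τ) ⇒ σ ⇒ ρ)
  Fix  : {σ : Ty} → Tm ((σ ⇒ σ) ⇒ σ)
  _·_  : {σ τ : Ty} → Tm (σ ⇒ τ) → Tm σ → Tm τ

num : ℕ → Tm ι
num zero    = Zero
num (suc n) = Succ · num n

infix 20 _~⇝_
data _~⇝_ : {σ : Ty} → Tm σ → Tm σ → Set where
  pred-zero : Pred · num 0 ~⇝ num 0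
  pred-suc  : {n : ℕ} → Pred · num (suc n) ~⇝ num n
  ifz-zero  : {s t : Tm ι} → Ifz · s · t · num 0 ~⇝ s
  ifz-suc   : {n : ℕ} {s t : Tm ι} → Ifz · s · t · num (suc n) ~⇝ t
  k-red     : {σ τ : Ty} {s : Tm σ} {t : Tm τ} → K · s · t ~⇝ s
  s-red     : {σ τ ρ : Ty} {f : Tm (σ ⇒ τ ⇒ ρ)} {g : Tm (σ ⇒ τ)} {t : Tm σ} →
              S · f · g · t ~⇝ f · t · (g · t)
  fix-red   : {σ : Ty} {f : Tm (σ ⇒ σ)} → Fix · f ~⇝ f · (Fix · f)
  app-red   : {σ τ : Ty} {f g : Tm (σ ⇒ τ)} {t : Tm σ} → f ~⇝ g → f · t ~⇝ g · t
  succ-red  : {s t : Tm ι} → s ~⇝ t → Succ · s ~⇝ Succ · t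
  pred-red  : {s t : Tm ι} → s ~⇝ t → Pred · s ~⇝ Pred · t
  ifz-red   : {s t r r' : Tm ι} → r ~⇝ r' → Ifz · s · t · r ~⇝ Ifz · s · t · r'

data Clo {a r : Level} {A : Set a} (R : A → A → Set r) : A → A → Set (a ⊔ℓ r) where
  extend : {x y : A} → R x y → Clo R x y
  refl*  : {x : A} → Clo R x x
  trans* : {x y z : A} → Clo R x y → Clo R y z → Clo R x z

isProp : {a : Level} → Set a → Set a
isProp A = (x y : A) → x ≡ y

isSet : {a : Level} → Set a → Set a
isSet A = (x y : A) → isProp (x ≡ y)

record PropTrunc : Setω where
  field
    ∥_∥       : {a : Level} → Set a → Set a
    ∣_∣       : {a : Level} {A : Set a} → A → ∥ A ∥
    ∥∥-isProp : {a : Level} {A : Set a} → isProp ∥ A ∥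
    ∥∥-rec    : {a b : Level} {A : Set a} {B : Set b} → isProp B → (A → B) → ∥ A ∥ → B

FunExt : Setω
FunExt = {a b : Level} → Extensionality a b

-- propositional extensionality (for propositions in 𝓤₀ = Set)
PropExt : Set₁
PropExt = {P Q : Set} → isProp P → isProp Q → (P → Q) → (Q → P) → P ≡ Q

module Reduction (pt : PropTrunc) where
  open PropTrunc pt

  infix 20 _⇝_ _⇝*_
  _⇝_ : {σ : Ty} → Tm σ → Tm σ → Set
  s ⇝ t = ∥ s ~⇝ t ∥

  _⇝*_ : {σ : Ty} → Tm σ → Tm σ → Set
  s ⇝* t = ∥ Clo _⇝_ s t ∥

module _ {a r : Level} {A : Set a} (R : A → A → Set r)
         (Rprop : (x y : A) → isProp (R x y)) (Rrefl : (x : A) → R x x)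
         (toEq : {x y : A} → R x y → x ≡ y) where
  private
    tr : {x y : A} → x ≡ y → R x y
    tr {x} p = subst (R x) p (Rrefl x)
    lem : {x y : A} (p : x ≡ y) → p ≡ trans (sym (toEq (Rrefl x))) (toEq (tr p))
    lem {x} refl = sym (trans-symˡ (toEq (Rrefl x)))
  relSet : isSet A
  relSet x y p q =
    trans (lem p)
      (trans (cong (λ z → trans (sym (toEq (Rrefl x))) (toEq z)) (Rprop x y (tr p) (tr q)))
             (sym (lem q)))

prop→set : {a : Level} {A : Set a} → isProp A → isSet A
prop→set {A = A} P = relSet (λ _ _ → ⊤) (λ _ _ _ _ → refl) (λ _ → tt) (λ {x} {y} _ → P x y)

Σ-prop-≡ : {a b : Level} {A : Set a} {B : A → Set b} → ((x : A) → isProp (B x)) →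
           {x y : A} {bx : B x} {by : B y} → x ≡ y → (x , bx) ≡ (y , by)
Σ-prop-≡ BP {x} {bx = bx} {by} refl = cong (x ,_) (BP x bx by)

ℕ-isSet : isSet ℕ
ℕ-isSet x y = ℕ-irr

×-prop : {a b : Level} {A : Set a} {B : Set b} → isProp A → isProp B → isProp (A × B)
×-prop pA pB (a , b) (a' , b') = cong₂ _,_ (pA a a') (pB b b')

module Model (pt : PropTrunc) (fe : FunExt) (pe : PropExt) where
  open PropTrunc pt

  Π-prop : {a b : Level} {A : Set a} {B : A → Set b} → ((x : A) → isProp (B x)) → isProp ((x : A) → B x)
  Π-prop P f g = fe (λ x → P x (f x) (g x))

  isProp-isProp : {a : Level} {A : Set a} → isProp (isProp A)
  isProp-isProp f g = fe (λ x → fe (λ y → prop→set f x y (f x y) (g x y)))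

  ∥map∥ : {a b : Level} {A : Set a} {B : Set b} → (A → B) → ∥ A ∥ → ∥ B ∥
  ∥map∥ f = ∥∥-rec ∥∥-isProp (λ a → ∣ f a ∣)

  Ω : Set₁
  Ω = Σ Set isProp

  𝓛 : Set → Set₁
  𝓛 X = Σ Ω (λ P → proj₁ P → X)

  isdefined : {X : Set} → 𝓛 X → Set
  isdefined l = proj₁ (proj₁ l)

  isdefined-prop : {X : Set} (l : 𝓛 X) → isProp (isdefined l)
  isdefined-prop l = proj₂ (proj₁ l)

  value : {X : Set} (l : 𝓛 X) → isdefined l → X
  value l = proj₂ l

  η : {X : Set} → X → 𝓛 X
  η x = ((⊤ , λ _ _ → refl) , λ _ → x)

  ⊥𝓛 : {X : Set} → 𝓛 X
  ⊥𝓛 = ((𝟘 , λ ()) , λ ())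

  𝓛map : {X Y : Set} → (X → Y) → 𝓛 X → 𝓛 Y
  𝓛map f (P , φ) = (P , f ∘ φ)

  _♯ : {X Y : Set} → (X → 𝓛 Y) → 𝓛 X → 𝓛 Y
  (g ♯) ((P , pP) , φ) =
    ((Σ P (λ p → isdefined (g (φ p))) ,
      (λ { (p , d) (p' , d') → Σ-prop-≡ (λ q → isdefined-prop (g (φ q))) (pP p p') })) ,
     λ { (p , d) → value (g (φ p)) d })

  𝓛-ext : {X : Set} (l m : 𝓛 X) → (isdefined l → isdefined m) → (isdefined m → isdefined l) →
          ((d : isdefined l) (e : isdefined m) → value l d ≡ value m e) → l ≡ m
  𝓛-ext ((P , pP) , φ) ((Q , pQ) , ψ) f g h = helper (pe pP pQ f g) pP pQ φ ψ h
    where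
    helper : {X : Set} {P Q : Set} (e : P ≡ Q) (pP : isProp P) (pQ : isProp Q) (φ : P → X) (ψ : Q → X) →
             ((d : P) (e : Q) → φ d ≡ ψ e) → ((P , pP) , φ) ≡ ((Q , pQ) , ψ)
    helper refl pP pQ φ ψ h = cong₂ (λ a b → ((_ , a) , b)) (isProp-isProp pP pQ) (fe (λ d → h d d))

  value-≡ : {X : Set} {l m : 𝓛 X} → l ≡ m → (d : isdefined l) (e : isdefined m) → value l d ≡ value m e
  value-≡ {l = l} refl d e = cong (value l) (isdefined-prop l d e)

  𝓛-isSet : {X : Set} → isSet X → isSet (𝓛 X)
  𝓛-isSet {X} sX = relSet R Rprop Rrefl (λ {l} {m} r → 𝓛-ext l m (proj₁ r) (proj₁ (proj₂ r)) (proj₂ (proj₂ r)))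
    where
    R : 𝓛 X → 𝓛 X → Set
    R l m = (isdefined l → isdefined m) × (isdefined m → isdefined l) ×
            ((d : isdefined l) (e : isdefined m) → value l d ≡ value m e)
    Rprop : (l m : 𝓛 X) → isProp (R l m)
    Rprop l m = ×-prop (Π-prop (λ _ → isdefined-prop m))
                 (×-prop (Π-prop (λ _ → isdefined-prop l))
                         (Π-prop (λ d → Π-prop (λ e → sX _ _))))
    Rrefl : (l : 𝓛 X) → R l l
    Rrefl l = id , id , λ d e → cong (value l) (isdefined-prop l d e)

  isDirected : {I : Set} {C : Set₁} → (C → C → Set₁) → (I → C) → Set₁
  isDirected {I} _≤_ u = ∥ I ∥ × ((i j : I) → ∥ Σ I (λ k → (u i ≤ u k) × (u j ≤ u k)) ∥)

  record DCPO : Set₂ where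
    field
      Carrier   : Set₁
      _⊑_       : Carrier → Carrier → Set₁
      ⊑-prop    : (x y : Carrier) → isProp (x ⊑ y)
      ⊑-refl    : (x : Carrier) → x ⊑ x
      ⊑-trans   : {x y z : Carrier} → x ⊑ y → y ⊑ z → x ⊑ z
      ⊑-antisym : {x y : Carrier} → x ⊑ y → y ⊑ x → x ≡ y
      ⊥         : Carrier
      ⊥-least   : (x : Carrier) → ⊥ ⊑ x
      ⨆         : {I : Set} (u : I → Carrier) → isDirected _⊑_ u → Carrier
      ⨆-ub      : {I : Set} (u : I → Carrier) (d : isDirected _⊑_ u) (i : I) → u i ⊑ ⨆ u d
      ⨆-lub     : {I : Set} (u : I → Carrier) (d : isDirected _⊑_ u) (x : Carrier) →
                  ((i : I) → u i ⊑ x) → ⨆ u d ⊑ x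

  open DCPO

  ⟨_⟩ : DCPO → Set₁
  ⟨ D ⟩ = Carrier D

  le : (D : DCPO) → ⟨ D ⟩ → ⟨ D ⟩ → Set₁
  le D = _⊑_ D
  syntax le D x y = x ⊑[ D ] y

  isSup : (D : DCPO) {I : Set} → (I → ⟨ D ⟩) → ⟨ D ⟩ → Set₁
  isSup D {I} u x = ((i : I) → u i ⊑[ D ] x) × ((y : ⟨ D ⟩) → ((i : I) → u i ⊑[ D ] y) → x ⊑[ D ] y)

  isSup-prop : (D : DCPO) {I : Set} (u : I → ⟨ D ⟩) (x : ⟨ D ⟩) → isProp (isSup D u x)
  isSup-prop D u x = ×-prop (Π-prop (λ i → ⊑-prop D _ _))
                            (Π-prop (λ y → Π-prop (λ _ → ⊑-prop D _ _)))

  ⨆-isSup : (D : DCPO) {I : Set} (u : I → ⟨ D ⟩) (d : isDirected (_⊑_ D) u) → isSup D u (⨆ D u d)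
  ⨆-isSup D u d = ⨆-ub D u d , ⨆-lub D u d

  sup-unique : (D : DCPO) {I : Set} {u : I → ⟨ D ⟩} {a b : ⟨ D ⟩} → isSup D u a → isSup D u b → a ≡ b
  sup-unique D sa sb = ⊑-antisym D (proj₂ sa _ (proj₁ sb)) (proj₂ sb _ (proj₁ sa))

  isContinuous : (D E : DCPO) → (⟨ D ⟩ → ⟨ E ⟩) → Set₁
  isContinuous D E f = (I : Set) (u : I → ⟨ D ⟩) (d : isDirected (_⊑_ D) u) → isSup E (f ∘ u) (f (⨆ D u d))

  isContinuous-prop : (D E : DCPO) (f : ⟨ D ⟩ → ⟨ E ⟩) → isProp (isContinuous D E f)
  isContinuous-prop D E f =
    Π-prop (λ I → Π-prop (λ u → Π-prop (λ d → isSup-prop E (f ∘ u) _)))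

  cont→mono : (D E : DCPO) (f : ⟨ D ⟩ → ⟨ E ⟩) → isContinuous D E f →
              {x y : ⟨ D ⟩} → x ⊑[ D ] y → f x ⊑[ E ] f y
  cont→mono D E f c {x} {y} x⊑y = subst (λ z → f x ⊑[ E ] f z) s≡y (proj₁ (c Bool u dir) true)
    where
    u : Bool → ⟨ D ⟩
    u true  = x
    u false = y
    ub : (i : Bool) → u i ⊑[ D ] y
    ub true  = x⊑y
    ub false = ⊑-refl D y
    dir : isDirected (_⊑_ D) u
    dir = ∣ true ∣ , λ i j → ∣ false , ub i , ub j ∣
    s≡y : ⨆ D u dir ≡ y
    s≡y = ⊑-antisym D (⨆-lub D u dir y ub) (⨆-ub D u dir false)

  image-directed : (D E : DCPO) (f : ⟨ D ⟩ → ⟨ E ⟩) → ({x y : ⟨ D ⟩} → x ⊑[ D ] y → f x ⊑[ E ] f y) →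
                   {I : Set} {u : I → ⟨ D ⟩} → isDirected (_⊑_ D) u → isDirected (_⊑_ E) (f ∘ u)
  image-directed D E f m d =
    proj₁ d , λ i j → ∥map∥ (λ { (k , a , b) → k , m a , m b }) (proj₂ d i j)

  cont-isSup : (D E : DCPO) (f : ⟨ D ⟩ → ⟨ E ⟩) → isContinuous D E f →
               {I : Set} {u : I → ⟨ D ⟩} {a : ⟨ D ⟩} → isDirected (_⊑_ D) u → isSup D u a → isSup E (f ∘ u) (f a)
  cont-isSup D E f c {I} {u} d s =
    subst (λ z → isSup E (f ∘ u) (f z)) (sup-unique D (⨆-isSup D u d) s) (c I u d)

  const-cont : (D E : DCPO) (c : ⟨ E ⟩) → isContinuous D E (λ _ → c)
  const-cont D E c I u d = (λ _ → ⊑-refl E c) , λ y h → ∥∥-rec (⊑-prop E c y) h (proj₁ d)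

  id-cont : (D : DCPO) → isContinuous D D id
  id-cont D I u d = ⨆-isSup D u d

  _⊑𝓛_ : 𝓛 ℕ → 𝓛 ℕ → Set₁
  l ⊑𝓛 m = isdefined l → l ≡ m

  𝓛ℕ-isSet : isSet (𝓛 ℕ)
  𝓛ℕ-isSet = 𝓛-isSet ℕ-isSet

  module Sup𝓛 {I : Set} (u : I → 𝓛 ℕ) (dir : isDirected _⊑𝓛_ u) where
    Q : Set
    Q = Σ ℕ (λ n → ∥ Σ I (λ i → Σ (isdefined (u i)) (λ d → value (u i) d ≡ n)) ∥)

    Q-prop : isProp Q
    Q-prop (n , t) (m , t') = Σ-prop-≡ (λ _ → ∥∥-isProp) nm
      where
      nm : n ≡ m
      nm = ∥∥-rec (ℕ-isSet n m) (λ { (i , d , p) →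
             ∥∥-rec (ℕ-isSet n m) (λ { (j , e , q) →
               ∥∥-rec (ℕ-isSet n m) (λ { (k , a , b) →
                 trans (sym p) (trans (value-≡ (trans (a d) (sym (b e))) d e) q) })
                 (proj₂ dir i j) }) t' }) t

    sup-def : Set
    sup-def = ∥ Σ I (λ i → isdefined (u i)) ∥

    toQ : sup-def → Q
    toQ = ∥∥-rec Q-prop (λ { (i , d) → value (u i) d , ∣ i , d , refl ∣ })

    sup : 𝓛 ℕ
    sup = ((sup-def , ∥∥-isProp) , λ t → proj₁ (toQ t))

    sup-ub : (i : I) → u i ⊑𝓛 sup
    sup-ub i d = 𝓛-ext (u i) sup (λ _ → ∣ i , d ∣) (λ _ → d)
                   (λ d' t → cong proj₁ (Q-prop (value (u i) d' , ∣ i , d' , refl ∣) (toQ t)))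

    sup-lub : (x : 𝓛 ℕ) → ((i : I) → u i ⊑𝓛 x) → sup ⊑𝓛 x
    sup-lub x h t = ∥∥-rec (𝓛ℕ-isSet sup x) (λ { (i , d) → trans (sym (sup-ub i d)) (h i d) }) t

  𝓛ℕ : DCPO
  𝓛ℕ = record
    { Carrier   = 𝓛 ℕ
    ; _⊑_       = _⊑𝓛_
    ; ⊑-prop    = λ l m → Π-prop (λ _ → 𝓛ℕ-isSet l m)
    ; ⊑-refl    = λ l _ → refl
    ; ⊑-trans   = λ h1 h2 d → trans (h1 d) (h2 (subst isdefined (h1 d) d))
    ; ⊑-antisym = λ {l} {m} h1 h2 → 𝓛-ext l m (λ d → subst isdefined (h1 d) d) (λ e → subst isdefined (h2 e) e)
                                      (λ d e → value-≡ (h1 d) d e)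
    ; ⊥         = ⊥𝓛
    ; ⊥-least   = λ m ()
    ; ⨆         = λ u d → Sup𝓛.sup u d
    ; ⨆-ub      = λ u d → Sup𝓛.sup-ub u d
    ; ⨆-lub     = λ u d → Sup𝓛.sup-lub u d
    }

  pw-dir : (D E : DCPO) {I : Set} (F : I → Σ (⟨ D ⟩ → ⟨ E ⟩) (isContinuous D E)) →
           isDirected (λ f g → (x : ⟨ D ⟩) → proj₁ f x ⊑[ E ] proj₁ g x) F →
           (x : ⟨ D ⟩) → isDirected (_⊑_ E) (λ i → proj₁ (F i) x)
  pw-dir D E F dF x = proj₁ dF , λ i j → ∥map∥ (λ { (k , a , b) → k , a x , b x }) (proj₂ dF i j)

  _⟹_ : DCPO → DCPO → DCPO
  D ⟹ E = record
    { Carrier   = Σ (⟨ D ⟩ → ⟨ E ⟩) (isContinuous D E)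
    ; _⊑_       = λ f g → (x : ⟨ D ⟩) → proj₁ f x ⊑[ E ] proj₁ g x
    ; ⊑-prop    = λ f g → Π-prop (λ x → ⊑-prop E _ _)
    ; ⊑-refl    = λ f x → ⊑-refl E _
    ; ⊑-trans   = λ h1 h2 x → ⊑-trans E (h1 x) (h2 x)
    ; ⊑-antisym = λ h1 h2 → Σ-prop-≡ (isContinuous-prop D E) (fe (λ x → ⊑-antisym E (h1 x) (h2 x)))
    ; ⊥         = (λ _ → ⊥ E) , const-cont D E (⊥ E)
    ; ⊥-least   = λ f x → ⊥-least E _
    ; ⨆         = λ F dF → (λ x → ⨆ E (λ i → proj₁ (F i) x) (pw-dir D E F dF x)) , sup-cont F dF
    ; ⨆-ub      = λ F dF i x → ⨆-ub E _ (pw-dir D E F dF x) i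
    ; ⨆-lub     = λ F dF g h x → ⨆-lub E _ (pw-dir D E F dF x) (proj₁ g x) (λ i → h i x)
    }
    where
    sup-cont : {I : Set} (F : I → Σ (⟨ D ⟩ → ⟨ E ⟩) (isContinuous D E))
               (dF : isDirected (λ f g → (x : ⟨ D ⟩) → proj₁ f x ⊑[ E ] proj₁ g x) F) →
               isContinuous D E (λ x → ⨆ E (λ i → proj₁ (F i) x) (pw-dir D E F dF x))
    sup-cont F dF J u du =
      (λ j → ⨆-lub E _ _ _ (λ i →
               ⊑-trans E (cont→mono D E (proj₁ (F i)) (proj₂ (F i)) (⨆-ub D u du j))
                         (⨆-ub E _ (pw-dir D E F dF (⨆ D u du)) i))) ,
      (λ y h → ⨆-lub E _ _ y (λ i →
               proj₂ (proj₂ (F i) J u du) y (λ j → ⊑-trans E (⨆-ub E _ (pw-dir D E F dF (u j)) i) (h j))))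

  infixr 30 _⟹_

  ev : {A B : Set₁} {P : (A → B) → Set₁} → Σ (A → B) P → A → B
  ev f x = proj₁ f x

  pw-isSup : (D E : DCPO) {I : Set} (F : I → ⟨ D ⟹ E ⟩) (G : ⟨ D ⟹ E ⟩) →
             ((x : ⟨ D ⟩) → isSup E (λ i → ev (F i) x) (ev G x)) → isSup (D ⟹ E) F G
  pw-isSup D E F G h = (λ i x → proj₁ (h x) i) , (λ y k x → proj₂ (h x) (ev y x) (λ i → k i x))

  sup-pw : (D E : DCPO) {I : Set} (F : I → ⟨ D ⟹ E ⟩) (G : ⟨ D ⟹ E ⟩) →
           isDirected (_⊑_ (D ⟹ E)) F → isSup (D ⟹ E) F G →
           (x : ⟨ D ⟩) → isSup E (λ i → ev (F i) x) (ev G x)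
  sup-pw D E F G dF s x =
    subst (λ (H : ⟨ D ⟹ E ⟩) → isSup E (λ i → ev (F i) x) (ev H x))
          (sup-unique (D ⟹ E) {u = F} {a = ⨆ (D ⟹ E) F dF} {b = G} (⨆-isSup (D ⟹ E) F dF) s)
          (⨆-isSup E _ (pw-dir D E F dF x))

  cont-pw : (D C E : DCPO) (f : ⟨ D ⟩ → ⟨ C ⟹ E ⟩) →
            ((c : ⟨ C ⟩) → isContinuous D E (λ x → ev (f x) c)) → isContinuous D (C ⟹ E) f
  cont-pw D C E f h I u d = pw-isSup C E (f ∘ u) (f (⨆ D u d)) (λ c → h c I u d)

  strict-cont : (f : 𝓛 ℕ → 𝓛 ℕ) → ({l m : 𝓛 ℕ} → l ⊑𝓛 m → f l ⊑𝓛 f m) →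
                ((l : 𝓛 ℕ) → isdefined (f l) → isdefined l) → isContinuous 𝓛ℕ 𝓛ℕ f
  strict-cont f mono strict I u d =
    (λ i → mono (⨆-ub 𝓛ℕ u d i)) ,
    (λ y h dd → ∥∥-rec (𝓛ℕ-isSet _ _)
                  (λ { (i , di) → let e = ⨆-ub 𝓛ℕ u d i di in
                       trans (cong f (sym e)) (h i (subst (λ z → isdefined (f z)) (sym e) dd)) })
                  (strict _ dd))

  𝓛map-cont : (g : ℕ → ℕ) → isContinuous 𝓛ℕ 𝓛ℕ (𝓛map g)
  𝓛map-cont g = strict-cont (𝓛map g) (λ h d → cong (𝓛map g) (h d)) (λ l d → d)

  ♯-eval : (g : ℕ → 𝓛 ℕ) (l : 𝓛 ℕ) (p : isdefined l) → (g ♯) l ≡ g (value l p)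
  ♯-eval g ((P , pP) , φ) p =
    𝓛-ext ((g ♯) ((P , pP) , φ)) (g (φ p))
      (λ { (p' , d) → subst (λ q → isdefined (g (φ q))) (pP p' p) d })
      (λ d → p , d)
      (λ { (p' , d) e → value-≡ (cong (g ∘ φ) (pP p' p)) d e })

  ♯-mono : (g : ℕ → 𝓛 ℕ) {l m : 𝓛 ℕ} → l ⊑𝓛 m → (g ♯) l ⊑𝓛 (g ♯) m
  ♯-mono g {((P , pP) , φ)} h (p , d) = cong (g ♯) (h p)

  ♯-cont : (g : ℕ → 𝓛 ℕ) → isContinuous 𝓛ℕ 𝓛ℕ (g ♯)
  ♯-cont g = strict-cont (g ♯) (♯-mono g) (λ { ((P , pP) , φ) (p , d) → p })

  ♯-param-cont : (h : 𝓛 ℕ → ℕ → 𝓛 ℕ) → ((n : ℕ) → isContinuous 𝓛ℕ 𝓛ℕ (λ a → h a n)) →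
                 (z : 𝓛 ℕ) → isContinuous 𝓛ℕ 𝓛ℕ (λ a → (h a ♯) z)
  ♯-param-cont h hc ((P , pP) , φ) I u d =
    (λ i → λ { (p , dd) →
       trans (♯-eval (h (u i)) z p)
         (trans (cont→mono 𝓛ℕ 𝓛ℕ (λ a → h a (φ p)) (hc (φ p)) (⨆-ub 𝓛ℕ u d i) dd)
                (sym (♯-eval (h (⨆ 𝓛ℕ u d)) z p))) }) ,
    (λ y k → λ { (p , dd) →
       trans (♯-eval (h (⨆ 𝓛ℕ u d)) z p)
         (proj₂ (hc (φ p) I u d) y (λ i di → trans (sym (♯-eval (h (u i)) z p)) (k i (p , di))) dd) })
    where
    z : 𝓛 ℕ
    z = ((P , pP) , φ)

  χ : 𝓛 ℕ → 𝓛 ℕ → ℕ → 𝓛 ℕ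
  χ x y zero    = x
  χ x y (suc n) = y

  iter : {D : DCPO} → (⟨ D ⟩ → ⟨ D ⟩) → ℕ → ⟨ D ⟩
  iter {D} f zero    = ⊥ D
  iter {D} f (suc n) = f (iter {D} f n)

  module Fix (D : DCPO) where
    DD : DCPO
    DD = D ⟹ D

    iter-chain : (f : ⟨ DD ⟩) (n : ℕ) → iter {D} (ev f) n ⊑[ D ] iter {D} (ev f) (suc n)
    iter-chain f zero    = ⊥-least D _
    iter-chain f (suc n) = cont→mono D D (ev f) (proj₂ f) (iter-chain f n)

    iter-+ : (f : ⟨ DD ⟩) (n k : ℕ) → iter {D} (ev f) n ⊑[ D ] iter {D} (ev f) (k + n)
    iter-+ f n zero    = ⊑-refl D _
    iter-+ f n (suc k) = ⊑-trans D (iter-+ f n k) (iter-chain f (k + n))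

    iter-dir : (f : ⟨ DD ⟩) → isDirected (_⊑_ D) (iter {D} (ev f))
    iter-dir f = ∣ 0 ∣ , λ i j → ∣ i + j ,
                   subst (λ m → iter {D} (ev f) i ⊑[ D ] iter {D} (ev f) m) (+-comm j i) (iter-+ f i j) ,
                   iter-+ f j i ∣

    μ₀ : ⟨ DD ⟩ → ⟨ D ⟩
    μ₀ f = ⨆ D (iter {D} (ev f)) (iter-dir f)

    iter-mono : (f g : ⟨ DD ⟩) → f ⊑[ DD ] g → (n : ℕ) → iter {D} (ev f) n ⊑[ D ] iter {D} (ev g) n
    iter-mono f g fg zero    = ⊑-refl D _
    iter-mono f g fg (suc n) = ⊑-trans D (cont→mono D D (ev f) (proj₂ f) (iter-mono f g fg n)) (fg _)

    μ-cont : isContinuous DD D μ₀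
    μ-cont I F dF =
      (λ i → ⨆-lub D _ _ _ (λ n → ⊑-trans D (iter-mono (F i) G (⨆-ub DD F dF i) n) (⨆-ub D _ _ n))) ,
      (λ y h → ⨆-lub D _ _ y (λ n → C n y (λ i → ⊑-trans D (⨆-ub D _ (iter-dir (F i)) n) (h i))))
      where
      G : ⟨ DD ⟩
      G = ⨆ DD F dF
      C : (n : ℕ) (z : ⟨ D ⟩) → ((i : I) → iter {D} (ev (F i)) n ⊑[ D ] z) → iter {D} (ev G) n ⊑[ D ] z
      C zero    z k = ⊥-least D z
      C (suc n) z k = ⨆-lub D _ (pw-dir D D F dF a) z goal
        where
        a : ⟨ D ⟩
        a = iter {D} (ev G) n
        v : I → ⟨ D ⟩
        v j = iter {D} (ev (F j)) n
        a-sup : isSup D v a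
        a-sup = (λ j → iter-mono (F j) G (⨆-ub DD F dF j) n) , (λ w hw → C n w hw)
        v-dir : isDirected (_⊑_ D) v
        v-dir = proj₁ dF , λ i j → ∥map∥ (λ { (k' , p , q) → k' , iter-mono (F i) (F k') p n , iter-mono (F j) (F k') q n }) (proj₂ dF i j)
        goal : (i : I) → ev (F i) a ⊑[ D ] z
        goal i = proj₂ (cont-isSup D D (ev (F i)) (proj₂ (F i)) v-dir a-sup) z
                   (λ j → ∥∥-rec (⊑-prop D _ _)
                            (λ { (k' , p , q) →
                               ⊑-trans D (cont→mono D D (ev (F i)) (proj₂ (F i)) (iter-mono (F j) (F k') q n))
                                         (⊑-trans D (p (v k')) (k k')) })
                            (proj₂ dF i j))

    μ : ⟨ DD ⟹ D ⟩
    μ = μ₀ , μ-cont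

  module SComb (D E R : DCPO) where
    inner : (f : ⟨ D ⟹ E ⟹ R ⟩) (g : ⟨ D ⟹ E ⟩) → isContinuous D R (λ x → ev (ev f x) (ev g x))
    inner f g I u d =
      (λ i → ⊑-trans R (cont→mono D (E ⟹ R) (ev f) (proj₂ f) (⨆-ub D u d i) (ev g (u i)))
                       (cont→mono E R (ev (ev f (⨆ D u d))) (proj₂ (ev f (⨆ D u d)))
                                  (cont→mono D E (ev g) (proj₂ g) (⨆-ub D u d i)))) ,
      (λ y h → proj₂ (sup-pw E R (ev f ∘ u) (ev f (⨆ D u d)) fdir (proj₂ f I u d) (ev g (⨆ D u d))) y
                 (λ i → proj₂ (cont-isSup E R (ev (ev f (u i))) (proj₂ (ev f (u i))) gdir (proj₂ g I u d)) y
                          (λ j → ∥∥-rec (⊑-prop R _ _)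
                                   (λ { (k , a , b) →
                                      ⊑-trans R (cont→mono E R (ev (ev f (u i))) (proj₂ (ev f (u i)))
                                                           (cont→mono D E (ev g) (proj₂ g) b))
                                        (⊑-trans R (cont→mono D (E ⟹ R) (ev f) (proj₂ f) a (ev g (u k))) (h k)) })
                                   (proj₂ d i j))))
      where
      fdir = image-directed D (E ⟹ R) (ev f) (cont→mono D (E ⟹ R) (ev f) (proj₂ f)) d
      gdir = image-directed D E (ev g) (cont→mono D E (ev g) (proj₂ g)) d

    lvl3 : (f : ⟨ D ⟹ E ⟹ R ⟩) (g : ⟨ D ⟹ E ⟩) → ⟨ D ⟹ R ⟩
    lvl3 f g = (λ x → ev (ev f x) (ev g x)) , inner f g

    lvl2 : (f : ⟨ D ⟹ E ⟹ R ⟩) → ⟨ (D ⟹ E) ⟹ D ⟹ R ⟩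
    lvl2 f = lvl3 f , cont-pw (D ⟹ E) D R (lvl3 f)
               (λ x I G dG → proj₂ (ev f x) I (λ i → ev (G i) x) (pw-dir D E G dG x))

    sComb : ⟨ (D ⟹ E ⟹ R) ⟹ (D ⟹ E) ⟹ D ⟹ R ⟩
    sComb = lvl2 , cont-pw (D ⟹ E ⟹ R) (D ⟹ E) (D ⟹ R) lvl2
              (λ g → cont-pw (D ⟹ E ⟹ R) D R (λ f → lvl3 f g)
                (λ x I F dF → ⨆-isSup R _ _))

  ⟦_⟧ty : Ty → DCPO
  ⟦ ι ⟧ty     = 𝓛ℕ
  ⟦ σ ⇒ τ ⟧ty = ⟦ σ ⟧ty ⟹ ⟦ τ ⟧ty

  ifz-inner : 𝓛 ℕ → ⟨ 𝓛ℕ ⟹ 𝓛ℕ ⟹ 𝓛ℕ ⟩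
  ifz-inner x = (λ y → (χ x y ♯) , ♯-cont (χ x y)) ,
                cont-pw 𝓛ℕ 𝓛ℕ 𝓛ℕ (λ y → (χ x y ♯) , ♯-cont (χ x y))
                  (♯-param-cont (χ x) (λ { zero → const-cont 𝓛ℕ 𝓛ℕ x ; (suc n) → id-cont 𝓛ℕ }))

  ⟦ifz⟧ : ⟨ 𝓛ℕ ⟹ 𝓛ℕ ⟹ 𝓛ℕ ⟹ 𝓛ℕ ⟩
  ⟦ifz⟧ = ifz-inner ,
          cont-pw 𝓛ℕ 𝓛ℕ (𝓛ℕ ⟹ 𝓛ℕ) ifz-inner
            (λ y → cont-pw 𝓛ℕ 𝓛ℕ 𝓛ℕ (λ x → ev (ifz-inner x) y)
              (♯-param-cont (λ a → χ a y) (λ { zero → id-cont 𝓛ℕ ; (suc n) → const-cont 𝓛ℕ 𝓛ℕ y })))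

  ⟦k⟧ : (D E : DCPO) → ⟨ D ⟹ E ⟹ D ⟩
  ⟦k⟧ D E = (λ x → (λ _ → x) , const-cont E D x) , cont-pw D E D (λ x → (λ _ → x) , const-cont E D x) (λ _ → id-cont D)

  ⟦_⟧ : {σ : Ty} → Tm σ → ⟨ ⟦ σ ⟧ty ⟩
  ⟦ Zero ⟧                 = η 0
  ⟦ Succ ⟧                 = 𝓛map suc , 𝓛map-cont suc
  ⟦ Pred ⟧                 = 𝓛map ℕpred , 𝓛map-cont ℕpred
  ⟦ Ifz ⟧                  = ⟦ifz⟧
  ⟦ K {σ} {τ} ⟧            = ⟦k⟧ ⟦ σ ⟧ty ⟦ τ ⟧ty
  ⟦ S {σ} {τ} {ρ} ⟧        = SComb.sComb ⟦ σ ⟧ty ⟦ τ ⟧ty ⟦ ρ ⟧ty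
  ⟦ Fix {σ} ⟧              = Fix.μ ⟦ σ ⟧ty
  ⟦ s · t ⟧                = ev ⟦ s ⟧ ⟦ t ⟧

-- Every reduction rule holds as an equation in the Scott model: the rules for pred, ifz, k and s
-- are computations of their interpretations, and fix f ⇝ f (fix f) is the fixed-point property of
-- μ f = ⨆ₙ fⁿ(⊥), which needs continuity of f. Since the carriers of the model are sets, equality in
-- them is a proposition, so the truncations in s ⇝* t can be eliminated into it.
module Submission where

open import Defs
open import Relation.Binary.PropositionalEquality using (_≡_; refl; sym; trans; cong)
open import Data.Nat using (ℕ; zero; suc; pred)
open import Data.Product using (_×_; _,_; proj₁; proj₂)
open import Data.Unit using (tt)
open import Level using (Level)

Clo-respects : {a b r : Level} {A : Set a} {B : Set b} {R : A → A → Set r} (f : A → B) →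
               (∀ {x y} → R x y → f x ≡ f y) → ∀ {x y} → Clo R x y → f x ≡ f y
Clo-respects f resp (extend r)   = resp r
Clo-respects f resp refl*        = refl
Clo-respects f resp (trans* p q) = trans (Clo-respects f resp p) (Clo-respects f resp q)

module Soundness (pt : PropTrunc) (fe : FunExt) (pe : PropExt) where
  open PropTrunc pt
  open Model pt fe pe
  open Reduction pt
  open DCPO

  DCPO-isSet : (D : DCPO) → isSet ⟨ D ⟩
  DCPO-isSet D = relSet (λ x y → (x ⊑[ D ] y) × (y ⊑[ D ] x))
    (λ x y → ×-prop (⊑-prop D x y) (⊑-prop D y x))
    (λ x → ⊑-refl D x , ⊑-refl D x)
    (λ x≈y → ⊑-antisym D (proj₁ x≈y) (proj₂ x≈y))

  μ-unfold : (D : DCPO) (f : ⟨ D ⟹ D ⟩) → ev (Fix.μ D) f ≡ ev f (ev (Fix.μ D) f)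
  μ-unfold D f = ⊑-antisym D μf⊑fμf fμf⊑μf
    where
    open Fix D
    fⁿ⊥ : ℕ → ⟨ D ⟩
    fⁿ⊥ = iter {D} (ev f)
    iterates-below : (n : ℕ) → fⁿ⊥ n ⊑[ D ] ev f (μ₀ f)
    iterates-below zero    = ⊥-least D _
    iterates-below (suc n) = cont→mono D D (ev f) (proj₂ f) (⨆-ub D fⁿ⊥ (iter-dir f) n)
    μf⊑fμf : μ₀ f ⊑[ D ] ev f (μ₀ f)
    μf⊑fμf = ⨆-lub D fⁿ⊥ (iter-dir f) (ev f (μ₀ f)) iterates-below
    -- f (⨆ₙ fⁿ ⊥) is the supremum of the shifted chain fⁿ⁺¹ ⊥, each term of which is below μ f.
    fμf⊑μf : ev f (μ₀ f) ⊑[ D ] μ₀ f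
    fμf⊑μf = proj₂ (proj₂ f ℕ fⁿ⊥ (iter-dir f)) (μ₀ f) (λ n → ⨆-ub D fⁿ⊥ (iter-dir f) (suc n))

  ⟦num⟧ : (n : ℕ) → ⟦ num n ⟧ ≡ η n
  ⟦num⟧ zero    = refl
  ⟦num⟧ (suc n) = cong (𝓛map suc) (⟦num⟧ n)

  ~⇝-sound : {σ : Ty} {s t : Tm σ} → s ~⇝ t → ⟦ s ⟧ ≡ ⟦ t ⟧
  ~⇝-sound pred-zero              = refl
  ~⇝-sound (pred-suc {n})         = trans (cong (𝓛map pred) (⟦num⟧ (suc n))) (sym (⟦num⟧ n))
  ~⇝-sound (ifz-zero {s} {t})     = ♯-eval (χ ⟦ s ⟧ ⟦ t ⟧) (η 0) tt
  ~⇝-sound (ifz-suc {n} {s} {t})  =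
    trans (cong (χ ⟦ s ⟧ ⟦ t ⟧ ♯) (⟦num⟧ (suc n))) (♯-eval (χ ⟦ s ⟧ ⟦ t ⟧) (η (suc n)) tt)
  ~⇝-sound k-red                  = refl
  ~⇝-sound s-red                  = refl
  ~⇝-sound (fix-red {σ} {f})      = μ-unfold ⟦ σ ⟧ty ⟦ f ⟧
  ~⇝-sound (app-red {t = t} r)    = cong (λ g → ev g ⟦ t ⟧) (~⇝-sound r)
  ~⇝-sound (succ-red r)           = cong (𝓛map suc) (~⇝-sound r)
  ~⇝-sound (pred-red r)           = cong (𝓛map pred) (~⇝-sound r)
  ~⇝-sound (ifz-red {s} {t} r)    = cong (χ ⟦ s ⟧ ⟦ t ⟧ ♯) (~⇝-sound r)

  ⇝-sound : {σ : Ty} {s t : Tm σ} → s ⇝ t → ⟦ s ⟧ ≡ ⟦ t ⟧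
  ⇝-sound {σ} = ∥∥-rec (DCPO-isSet ⟦ σ ⟧ty _ _) ~⇝-sound

  ⇝*-sound : {σ : Ty} {s t : Tm σ} → s ⇝* t → ⟦ s ⟧ ≡ ⟦ t ⟧
  ⇝*-sound {σ} = ∥∥-rec (DCPO-isSet ⟦ σ ⟧ty _ _) (Clo-respects ⟦_⟧ ⇝-sound)

theorem7p1 : (pt : PropTrunc) (fe : FunExt) (pe : PropExt) {σ : Ty} (s t : Tm σ) →
    Reduction._⇝*_ pt s t → Model.⟦_⟧ pt fe pe s ≡ Model.⟦_⟧ pt fe pe t
theorem7p1 pt fe pe s t = Soundness.⇝*-sound pt fe pe
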